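{- Let $\mathcal{F}_{\mathrm{cubic}}$ be the family of graphs described in the context. If $G \in \mathcal{F}_{\mathrm{cubic}}$ has order $n$, then $n \ge 16$, $n \equiv 0 \pmod 8$, and $i(G) = \frac{3}{8}n$.
   Context: A set $S$ of vertices of a graph $G$ is an independent dominating set if $S$ is independent and every vertex not in $S$ is adjacent to a vertex of $S$; $i(G)$ denotes the minimum cardinality of an independent dominating set of $G$. Let $X$ be the graph on vertices $a_1,a_2,b_1,b_2,b_3,c_1,c_2,c_3$ with edges $a_jb_i$ for all $j\in\{1,2\}$, $i\in\{1,2,3\}$, the edges $b_ic_i$ for $i\in\{1,2,3\}$, and the edge $c_2c_3$. (So in $X$, $c_1$ has degree $1$, and $c_2,c_3$ are the two adjacent vertices of degree $2$.) Let $Y$ be the graph obtained from $X$ by adding the edge $c_1c_2$ (so in $Y$ the vertices of degree $2$ are $c_1$ and $c_3$). The family $\mathcal{F}_{\mathrm{cubic}}$: take a cycle $v_1v_2\ldots v_kv_1$ with $k\ge 2$ (for $k=2$ this means two vertices joined by two parallel edges) and color each $v_i$ red or blue so that the number of red vertices is even; when $k=2$ both vertices are blue. Replace each red $v_i$ by a copy $G_i$ of $X$ and each blue $v_i$ by a copy $G_i$ of $Y$. Partition the $X$-copies into pairs; for each pair $\{X_1,X_2\}$, if $v_{j1},v_{j2}$ are the two adjacent degree-2 vertices of $X_j$ ($j=1,2$), add the edges $v_{11}v_{21}$ and $v_{12}v_{22}$. For an $X$-copy $G_i$ let $x_i$ be its vertex of degree $1$ in $X$; for a $Y$-copy $G_i$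 let $y_i^1,y_i^2$ be its two vertices of degree $2$ in $Y$. For each $i\in[k]$ (indices modulo $k$) add one edge between $G_i$ and $G_{i+1}$: $x_ix_{i+1}$ if both are $X$-copies; $y_i^2y_{i+1}^1$ if both are $Y$-copies; $x_iy_{i+1}^1$ if $G_i$ is an $X$-copy and $G_{i+1}$ a $Y$-copy; $y_i^2x_{i+1}$ if $G_i$ is a $Y$-copy and $G_{i+1}$ an $X$-copy. The resulting connected cubic graphs form $\mathcal{F}_{\mathrm{cubic}}$. -}

module Defs where

open import Data.Nat using (ℕ; zero; suc; _+_; _*_; _≤_; _≥_)
open import Data.Nat.Divisibility using (_∣_)
open import Data.Fin using (Fin; toℕ; #_)
open import Data.Fin.Subset using (Subset; _∈_; _∉_; ∣_∣)
open import Data.Bool using (Bool; true; false; if_then_else_)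
open import Data.List using (List; map; allFin)
open import Data.Nat.ListAction using (sum)
open import Data.Product using (Σ; ∃; _×_; _,_)
open import Data.Sum using (_⊎_)
open import Relation.Binary.PropositionalEquality using (_≡_; _≢_)
open import Relation.Nullary using (¬_)
open import Function.Bundles using (_⤖_; Bijection)

record Graph (n : ℕ) : Set₁ where
  field
    Adj   : Fin n → Fin n → Set
    sym   : ∀ {u v} → Adj u v → Adj v u
    irrefl : ∀ {u} → ¬ Adj u u
open Graph public

module _ {n : ℕ} (G : Graph n) where

  IsIndependent : Subset n → Set
  IsIndependent S = ∀ u v → u ∈ S → v ∈ S → ¬ Adj G u v

  IsDominating : Subset n → Set
  IsDominating S = ∀ v → v ∉ S → ∃ λ u → u ∈ S × Adj G v u

  IsIndepDom : Subset n → Set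
  IsIndepDom S = IsIndependent S × IsDominating S

  IndepDomNumber : ℕ → Set
  IndepDomNumber m =
    (∃ λ S → IsIndepDom S × ∣ S ∣ ≡ m) × (∀ S → IsIndepDom S → m ≤ ∣ S ∣)

-- Local vertex labels of a gadget (copy of X or Y), as Fin 8:
--   0 = a₁, 1 = a₂, 2 = b₁, 3 = b₂, 4 = b₃, 5 = c₁, 6 = c₂, 7 = c₃.
-- In X: x = c₁ (degree 1), the two adjacent degree-2 vertices are c₂, c₃.
-- In Y: y¹ = c₁, y² = c₃ (degree 2 vertices).

data BaseEdge : Fin 8 → Fin 8 → Set where
  a1b1 : BaseEdge (# 0) (# 2)
  a1b2 : BaseEdge (# 0) (# 3)
  a1b3 : BaseEdge (# 0) (# 4)
  a2b1 : BaseEdge (# 1) (# 2)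
  a2b2 : BaseEdge (# 1) (# 3)
  a2b3 : BaseEdge (# 1) (# 4)
  b1c1 : BaseEdge (# 2) (# 5)
  b2c2 : BaseEdge (# 3) (# 6)
  b3c3 : BaseEdge (# 4) (# 7)
  c2c3 : BaseEdge (# 6) (# 7)

-- Edges of X (red = true) resp. Y (red = false)
data GadgetEdge : Bool → Fin 8 → Fin 8 → Set where
  base : ∀ {r u v} → BaseEdge u v → GadgetEdge r u v
  c1c2 : GadgetEdge false (# 5) (# 6)

CycSucc : {k : ℕ} → Fin k → Fin k → Set
CycSucc {k} i j = (suc (toℕ i) ≡ toℕ j) ⊎ (suc (toℕ i) ≡ k × toℕ j ≡ 0)

numRed : {k : ℕ} → (Fin k → Bool) → ℕ
numRed {k} red = sum (map (λ i → if red i then 1 else 0) (allFin k))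

record CubicParams : Set where
  field
    k        : ℕ
    k≥2      : k ≥ 2
    red      : Fin k → Bool            -- true = red (X-copy), false = blue (Y-copy)
    evenRed  : 2 ∣ numRed red
    k≡2⇒blue : k ≡ 2 → ∀ i → red i ≡ false
    -- partition of the X-copies into pairs: a fixed-point-free involution on red indices
    pair     : Fin k → Fin k
    pairRed  : ∀ i → red i ≡ true → red (pair i) ≡ true
    pairNeq  : ∀ i → red i ≡ true → pair i ≢ i
    pairInv  : ∀ i → red i ≡ true → pair (pair i) ≡ i
open CubicParams public

-- the vertex of G_i sending the cycle edge to G_{i+1}: x_i (= c₁) or y_i² (= c₃)
outPort : Bool → Fin 8
outPort true  = # 5
outPort false = # 7

-- the vertex of G_{i+1} receiving the cycle edge: x_{i+1} or y_{i+1}¹ (both c₁)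
inPort : Fin 8
inPort = # 5

module _ (P : CubicParams) where
  Vtx : Set
  Vtx = Fin (k P) × Fin 8

  data Edge : Vtx → Vtx → Set where
    inner  : ∀ {i u v} → GadgetEdge (red P i) u v → Edge (i , u) (i , v)
    pair2  : ∀ {i} → red P i ≡ true → Edge (i , # 6) (pair P i , # 6)
    pair3  : ∀ {i} → red P i ≡ true → Edge (i , # 7) (pair P i , # 7)
    cycle  : ∀ {i j} → CycSucc i j → Edge (i , outPort (red P i)) (j , inPort)

  CAdj : Vtx → Vtx → Set
  CAdj u v = Edge u v ⊎ Edge v u

InFcubic : {n : ℕ} → Graph n → Set
InFcubic {n} G = Σ CubicParams λ P → Σ (Fin n ⤖ Vtx P) λ f →
  ∀ u v → (Adj G u v → CAdj P (Bijection.to f u) (Bijection.to f v))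
        × (CAdj P (Bijection.to f u) (Bijection.to f v) → Adj G u v)

-- A member of F_cubic built from k gadgets has n = 8k vertices, and k ≥ 2.
-- The b-vertices of all gadgets form an independent dominating set of size 3k.
-- Conversely an independent dominating set S meets every gadget in at least
-- three vertices.  If S contains no a-vertex, then each b_i, whose
-- neighbours are a₁, a₂, c_i, forces b_i or c_i into S.  If S contains an
-- a-vertex, it contains no b-vertex, hence both a-vertices (their
-- neighbourhoods are {b₁, b₂, b₃}), and some c-vertex: otherwise c₂ and c₃
-- are dominated from outside the gadget, which is impossible for a Y-copy
-- (c₂ has no outside neighbour) and for an X-copy would put the two adjacent
-- vertices c₂, c₃ of the partner gadget into S.

module Submission where

open import Defs
open import Data.Nat using (ℕ; _*_; _≥_)
open import Data.Nat.Divisibility using (_∣_)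
open import Data.Product using (∃; _×_)
open import Relation.Binary.PropositionalEquality using (_≡_)

open import Data.Bool using (Bool; true; false; _≟_)
open import Data.Bool.Properties using (¬-not)
open import Data.Fin using (Fin; zero; suc; _↑ˡ_; _↑ʳ_; remQuot; combine)
open import Data.Fin.Patterns using (0F; 1F; 2F; 3F; 4F; 5F; 6F; 7F)
open import Data.Fin.Permutation using (↔⇒≡)
open import Data.Fin.Properties using (remQuot-combine; *↔×)
open import Data.Fin.Subset using (Subset; _∈_; ∣_∣)
open import Data.Nat using (zero; suc; _+_; _≤_; z≤n; s≤s)
open import Data.Nat.Divisibility using (divides)
open import Data.Nat.Properties
  using (+-assoc; +-mono-≤; *-monoˡ-≤; ≤-trans; m≤n+m; +-0-commutativeMonoid)
open import Algebra.Properties.CommutativeMonoid.Sum +-0-commutativeMonoid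
  using (sum; sum-syntax; ∑-permute; sum-cong-≗)
open import Data.Nat.Tactic.RingSolver using (solve-∀)
open import Data.Product using (_,_; proj₁; proj₂)
open import Data.Sum using (_⊎_; inj₁; inj₂)
open import Data.Vec using ([]; _∷_; lookup; tabulate)
open import Data.Vec.Properties using (lookup∘tabulate; []=⇒lookup; lookup⇒[]=)
open import Function using (_∘_)
open import Function.Bundles using (_⤖_; _↔_; Inverse; Bijection)
open import Function.Construct.Composition using (_↔-∘_)
open import Function.Construct.Symmetry using (↔-sym)
open import Function.Properties.Bijection using (⤖⇒↔)
open import Relation.Binary.PropositionalEquality
  using (_≢_; refl; trans; cong; subst; subst₂; module ≡-Reasoning)
  renaming (sym to ≡-sym)
open import Relation.Nullary using (¬_; yes; no; contradiction)

bit : Bool → ℕ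
bit true  = 1
bit false = 0

∣p∣≡∑bit : ∀ {n} (p : Subset n) → ∣ p ∣ ≡ ∑[ u < n ] bit (lookup p u)
∣p∣≡∑bit []          = refl
∣p∣≡∑bit (true ∷ p)  = cong suc (∣p∣≡∑bit p)
∣p∣≡∑bit (false ∷ p) = ∣p∣≡∑bit p

∑bit-≥1 : ∀ {n} (x : Fin n → Bool) {j} → x j ≡ true → 1 ≤ ∑[ i < n ] bit (x i)
∑bit-≥1 x {zero}  p rewrite p = s≤s z≤n
∑bit-≥1 x {suc j} p = ≤-trans (∑bit-≥1 (x ∘ suc) p) (m≤n+m _ (bit (x zero)))

bit-∨ : ∀ {x y} → x ≡ true ⊎ y ≡ true → 1 ≤ bit x + bit y
bit-∨ {true}          _ = s≤s z≤n
bit-∨ {false} {true}  _ = s≤s z≤n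
bit-∨ {false} {false} (inj₁ ())
bit-∨ {false} {false} (inj₂ ())

sum-const : ∀ k c → ∑[ i < k ] c ≡ k * c
sum-const zero    c = refl
sum-const (suc k) c = cong (c +_) (sum-const k c)

sum-mono-≤ : ∀ {k} {f g : Fin k → ℕ} → (∀ i → f i ≤ g i) → sum f ≤ sum g
sum-mono-≤ {zero}  f≤g = z≤n
sum-mono-≤ {suc k} f≤g = +-mono-≤ (f≤g zero) (sum-mono-≤ (f≤g ∘ suc))

sum-↑ : ∀ m {n} (f : Fin (m + n) → ℕ) →
        sum f ≡ sum (f ∘ (_↑ˡ n)) + sum (f ∘ (m ↑ʳ_))
sum-↑ zero    f = refl
sum-↑ (suc m) f =
  trans (cong (f zero +_) (sum-↑ m (f ∘ suc))) (≡-sym (+-assoc (f zero) _ _))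

sum-combine : ∀ m {n} (f : Fin (m * n) → ℕ) →
              ∑[ i < m ] ∑[ j < n ] f (combine i j) ≡ sum f
sum-combine zero        f = refl
sum-combine (suc m) {n} f =
  trans (cong (sum (f ∘ (_↑ˡ m * n)) +_) (sum-combine m (f ∘ (n ↑ʳ_))))
        (≡-sym (sum-↑ n f))

sum-↔-× : ∀ {n m k} (e : Fin n ↔ (Fin m × Fin k)) (f : Fin n → ℕ) →
          sum f ≡ ∑[ i < m ] ∑[ j < k ] f (Inverse.from e (i , j))
sum-↔-× {n} {m} {k} e f = begin
  sum f                                                  ≡⟨ ∑-permute f π ⟩
  ∑[ c < m * k ] f (from (remQuot k c))                  ≡⟨ sum-combine m _ ⟨
  ∑[ i < m ] ∑[ j < k ] f (from (remQuot k (combine i j)))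
    ≡⟨ sum-cong-≗ (λ i → sum-cong-≗ (λ j → cong (f ∘ from) (remQuot-combine i j))) ⟩
  ∑[ i < m ] ∑[ j < k ] f (from (i , j))                 ∎
  where
  open ≡-Reasoning
  from = Inverse.from e
  π : Fin (m * k) ↔ Fin n
  π = ↔-sym e ↔-∘ *↔×

GadgetAdj : Bool → Fin 8 → Fin 8 → Set
GadgetAdj r u v = GadgetEdge r u v ⊎ GadgetEdge r v u

data IsA : Fin 8 → Set where
  a₁ : IsA 0F
  a₂ : IsA 1F

data IsB : Fin 8 → Set where
  b₁ : IsB 2F
  b₂ : IsB 3F
  b₃ : IsB 4F

C-mate : ∀ {b} → IsB b → Fin 8
C-mate b₁ = 5F
C-mate b₂ = 6F
C-mate b₃ = 7F

Interior : Fin 8 → Set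
Interior j = IsA j ⊎ IsB j

A-B-edge : ∀ {a b} → IsA a → IsB b → BaseEdge a b
A-B-edge a₁ b₁ = a1b1
A-B-edge a₁ b₂ = a1b2
A-B-edge a₁ b₃ = a1b3
A-B-edge a₂ b₁ = a2b1
A-B-edge a₂ b₂ = a2b2
A-B-edge a₂ b₃ = a2b3

A-neighbour-is-B : ∀ {r a l} → IsA a → GadgetAdj r a l → IsB l
A-neighbour-is-B a₁ (inj₁ (base a1b1)) = b₁
A-neighbour-is-B a₁ (inj₁ (base a1b2)) = b₂
A-neighbour-is-B a₁ (inj₁ (base a1b3)) = b₃
A-neighbour-is-B a₂ (inj₁ (base a2b1)) = b₁
A-neighbour-is-B a₂ (inj₁ (base a2b2)) = b₂
A-neighbour-is-B a₂ (inj₁ (base a2b3)) = b₃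
A-neighbour-is-B a₁ (inj₂ (base ()))
A-neighbour-is-B a₂ (inj₂ (base ()))

module Gadget (r : Bool) (t : Fin 8 → Bool) where

  Independent : Set
  Independent = ∀ {u v} → GadgetEdge r u v → t u ≡ true → t v ≢ true

  Dominated : Fin 8 → Set
  Dominated j = ∃ λ l → (l ≡ j ⊎ GadgetAdj r j l) × t l ≡ true

  size : ℕ
  size = ∑[ j < 8 ] bit (t j)

  dominated-by-itself : ∀ {j} → Dominated j → (∀ {l} → GadgetAdj r j l → t l ≢ true) →
                   t j ≡ true
  dominated-by-itself (_ , inj₁ refl , p) _    = p
  dominated-by-itself (_ , inj₂ e    , p) out = contradiction p (out e)

  size-≥3-with-A : (∀ {b} → IsB b → t b ≢ true) → (∀ {a} → IsA a → t a ≡ true) →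
                  Dominated 6F ⊎ Dominated 7F → 3 ≤ size
  size-≥3-with-A b∉ a∈ tail
    rewrite a∈ a₁ | a∈ a₂ | ¬-not (b∉ b₁) | ¬-not (b∉ b₂) | ¬-not (b∉ b₃) =
    s≤s (s≤s (some-c tail))
    where
    t-C : Fin 3 → Bool
    t-C i = t (5 ↑ʳ i)
    some-c : Dominated 6F ⊎ Dominated 7F → 1 ≤ ∑[ i < 3 ] bit (t-C i)
    some-c (inj₁ (_ , inj₁ refl                , p)) = ∑bit-≥1 t-C {1F} p
    some-c (inj₁ (_ , inj₂ (inj₁ (base c2c3))  , p)) = ∑bit-≥1 t-C {2F} p
    some-c (inj₁ (_ , inj₂ (inj₂ c1c2)         , p)) = ∑bit-≥1 t-C {0F} p
    some-c (inj₁ (_ , inj₂ (inj₂ (base b2c2))  , p)) = contradiction p (b∉ b₂)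
    some-c (inj₂ (_ , inj₁ refl                , p)) = ∑bit-≥1 t-C {2F} p
    some-c (inj₂ (_ , inj₂ (inj₁ (base ()))    , _))
    some-c (inj₂ (_ , inj₂ (inj₂ (base c2c3))  , p)) = ∑bit-≥1 t-C {1F} p
    some-c (inj₂ (_ , inj₂ (inj₂ (base b3c3))  , p)) = contradiction p (b∉ b₃)

  size-≥3-without-A : t 0F ≡ false → t 1F ≡ false →
                      (∀ {b} → IsB b → Dominated b) → 3 ≤ size
  size-≥3-without-A a₁∉ a₂∉ dom rewrite a₁∉ | a₂∉ =
    subst (3 ≤_) (regroup (bit (t 2F)) (bit (t 3F)) (bit (t 4F))
                          (bit (t 5F)) (bit (t 6F)) (bit (t 7F)))
      (+-mono-≤ (bit-∨ (rung b₁ (dom b₁)))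
        (+-mono-≤ (bit-∨ (rung b₂ (dom b₂))) (bit-∨ (rung b₃ (dom b₃)))))
    where
    regroup : ∀ x₂ x₃ x₄ x₅ x₆ x₇ → (x₂ + x₅) + ((x₃ + x₆) + (x₄ + x₇))
                                   ≡ x₂ + (x₃ + (x₄ + (x₅ + (x₆ + (x₇ + 0)))))
    regroup = solve-∀
    a∉ : ∀ {a} → IsA a → t a ≢ true
    a∉ a₁ p = contradiction (trans (≡-sym p) a₁∉) λ ()
    a∉ a₂ p = contradiction (trans (≡-sym p) a₂∉) λ ()
    rung : ∀ {j} (b : IsB j) → Dominated j → t j ≡ true ⊎ t (C-mate b) ≡ true
    rung _  (_ , inj₁ refl               , p) = inj₁ p
    rung b₁ (_ , inj₂ (inj₁ (base b1c1)) , p) = inj₂ p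
    rung b₂ (_ , inj₂ (inj₁ (base b2c2)) , p) = inj₂ p
    rung b₃ (_ , inj₂ (inj₁ (base b3c3)) , p) = inj₂ p
    rung _  (_ , inj₂ (inj₂ (base a1b1)) , p) = contradiction p (a∉ a₁)
    rung _  (_ , inj₂ (inj₂ (base a1b2)) , p) = contradiction p (a∉ a₁)
    rung _  (_ , inj₂ (inj₂ (base a1b3)) , p) = contradiction p (a∉ a₁)
    rung _  (_ , inj₂ (inj₂ (base a2b1)) , p) = contradiction p (a∉ a₂)
    rung _  (_ , inj₂ (inj₂ (base a2b2)) , p) = contradiction p (a∉ a₂)
    rung _  (_ , inj₂ (inj₂ (base a2b3)) , p) = contradiction p (a∉ a₂)

  size-≥3 : Independent → (∀ {j} → Interior j → Dominated j) →
            Dominated 6F ⊎ Dominated 7F → 3 ≤ size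
  size-≥3 ind dom tail = cases (t 0F) refl (t 1F) refl
    where
    via : ∀ {a} → IsA a → t a ≡ true → 3 ≤ size
    via a p = size-≥3-with-A b∉ a∈ tail
      where
      b∉ : ∀ {b} → IsB b → t b ≢ true
      b∉ b = ind (base (A-B-edge a b)) p
      a∈ : ∀ {a′} → IsA a′ → t a′ ≡ true
      a∈ a′ = dominated-by-itself (dom (inj₁ a′)) (b∉ ∘ A-neighbour-is-B a′)
    cases : ∀ x → t 0F ≡ x → ∀ y → t 1F ≡ y → 3 ≤ size
    cases true  p _     _ = via a₁ p
    cases false _ true  q = via a₂ q
    cases false p false q = size-≥3-without-A p q (dom ∘ inj₂)

data Port (r : Bool) : Fin 8 → Set where
  c₁ : Port r 5F
  c₃ : r ≡ false → Port r 7F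

outPort-is-port : ∀ r → Port r (outPort r)
outPort-is-port true  = c₁
outPort-is-port false = c₃ refl

isB : Fin 8 → Bool
isB 2F = true
isB 3F = true
isB 4F = true
isB _  = false

isB-no-gadget-edge : ∀ {r u v} → GadgetEdge r u v → isB u ≡ true → isB v ≢ true
isB-no-gadget-edge (base a1b1) ()
isB-no-gadget-edge (base a1b2) ()
isB-no-gadget-edge (base a1b3) ()
isB-no-gadget-edge (base a2b1) ()
isB-no-gadget-edge (base a2b2) ()
isB-no-gadget-edge (base a2b3) ()
isB-no-gadget-edge (base b1c1) _ ()
isB-no-gadget-edge (base b2c2) _ ()
isB-no-gadget-edge (base b3c3) _ ()
isB-no-gadget-edge (base c2c3) ()
isB-no-gadget-edge c1c2 ()

B-neighbour : ∀ {r} j → isB j ≢ true → ∃ λ l → isB l ≡ true × GadgetAdj r j l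
B-neighbour 0F _ = 2F , refl , inj₁ (base a1b1)
B-neighbour 1F _ = 2F , refl , inj₁ (base a2b1)
B-neighbour 2F ¬b = contradiction refl ¬b
B-neighbour 3F ¬b = contradiction refl ¬b
B-neighbour 4F ¬b = contradiction refl ¬b
B-neighbour 5F _ = 2F , refl , inj₂ (base b1c1)
B-neighbour 6F _ = 3F , refl , inj₂ (base b2c2)
B-neighbour 7F _ = 4F , refl , inj₂ (base b3c3)

module Construction (P : CubicParams) where

  data External : Vtx P → Vtx P → Set where
    partner₂ : ∀ {i} → red P i ≡ true → External (i , 6F) (pair P i , 6F)
    partner₃ : ∀ {i} → red P i ≡ true → External (i , 7F) (pair P i , 7F)
    port     : ∀ {i j w} → Port (red P i) j → External (i , j) w

  neighbour-cases : ∀ {i j w} → CAdj P (i , j) w →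
    (∃ λ l → w ≡ (i , l) × GadgetAdj (red P i) j l) ⊎ External (i , j) w
  neighbour-cases (inj₁ (inner e)) = inj₁ (_ , refl , inj₁ e)
  neighbour-cases (inj₁ (pair2 r)) = inj₂ (partner₂ r)
  neighbour-cases (inj₁ (pair3 r)) = inj₂ (partner₃ r)
  neighbour-cases (inj₁ (cycle {i} _)) = inj₂ (port (outPort-is-port (red P i)))
  neighbour-cases (inj₂ (inner e)) = inj₁ (_ , refl , inj₂ e)
  neighbour-cases (inj₂ (pair2 {i} r)) =
    inj₂ (subst (External _) (cong (_, 6F) (pairInv P i r)) (partner₂ (pairRed P i r)))
  neighbour-cases (inj₂ (pair3 {i} r)) =
    inj₂ (subst (External _) (cong (_, 7F) (pairInv P i r)) (partner₃ (pairRed P i r)))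
  neighbour-cases (inj₂ (cycle _)) = inj₂ (port c₁)

  interior-not-external : ∀ {i j w} → Interior j → ¬ External (i , j) w
  interior-not-external (inj₁ a₁) (port ())
  interior-not-external (inj₁ a₂) (port ())
  interior-not-external (inj₂ b₁) (port ())
  interior-not-external (inj₂ b₂) (port ())
  interior-not-external (inj₂ b₃) (port ())

  Independent : (Vtx P → Bool) → Set
  Independent T = ∀ {x y} → CAdj P x y → T x ≡ true → T y ≢ true

  Dominating : (Vtx P → Bool) → Set
  Dominating T = ∀ x → T x ≢ true → ∃ λ y → T y ≡ true × CAdj P x y

  size : (Vtx P → Bool) → ℕ
  size T = ∑[ i < k P ] Gadget.size (red P i) (λ j → T (i , j))

  module _ (T : Vtx P → Bool) where
    open module G i = Gadget (red P i) (λ j → T (i , j))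
      using (Dominated)

    dominated-or-external : Dominating T → ∀ i j →
      Dominated i j ⊎ ∃ λ w → T w ≡ true × External (i , j) w
    dominated-or-external dom i j with T (i , j) ≟ true
    ... | yes p = inj₁ (j , inj₁ refl , p)
    ... | no ¬p with dom (i , j) ¬p
    ...   | w , p , adj with neighbour-cases adj
    ...     | inj₁ (l , refl , e) = inj₁ (l , inj₂ e , p)
    ...     | inj₂ ext            = inj₂ (w , p , ext)

    interior-dominated : Dominating T → ∀ i {j} → Interior j → Dominated i j
    interior-dominated dom i {j} int with dominated-or-external dom i j
    ... | inj₁ d             = d
    ... | inj₂ (_ , _ , ext) = contradiction ext (interior-not-external int)

    tail-dominated : Independent T → Dominating T → ∀ i → Dominated i 6F ⊎ Dominated i 7F
    tail-dominated ind dom i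
      with dominated-or-external dom i 6F | dominated-or-external dom i 7F
    ... | inj₁ d | _      = inj₁ d
    ... | inj₂ _ | inj₁ d = inj₂ d
    ... | inj₂ (_ , p , partner₂ _) | inj₂ (_ , q , partner₃ _) =
      contradiction q (ind (inj₁ (inner (base c2c3))) p)
    ... | inj₂ (_ , _ , partner₂ red) | inj₂ (_ , _ , port (c₃ blue)) =
      contradiction (trans (≡-sym red) blue) λ ()
    ... | inj₂ (_ , _ , port ()) | _

    size-≥3k : Independent T → Dominating T → k P * 3 ≤ size T
    size-≥3k ind dom = subst (_≤ size T) (sum-const (k P) 3) (sum-mono-≤ gadget-size-≥3)
      where
      gadget-size-≥3 : ∀ i → 3 ≤ G.size i
      gadget-size-≥3 i = G.size-≥3 i (λ e → ind (inj₁ (inner e)))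
                      (interior-dominated dom i) (tail-dominated ind dom i)

  B : Vtx P → Bool
  B (_ , j) = isB j

  size-B : size B ≡ k P * 3
  size-B = sum-const (k P) 3

  B-independent : Independent B
  B-independent (inj₁ (inner e)) p q = isB-no-gadget-edge e p q
  B-independent (inj₂ (inner e)) p q = isB-no-gadget-edge e q p
  B-independent (inj₁ (pair2 _)) ()
  B-independent (inj₁ (pair3 _)) ()
  B-independent (inj₁ (cycle _)) _ ()
  B-independent (inj₂ (pair2 _)) ()
  B-independent (inj₂ (pair3 _)) ()
  B-independent (inj₂ (cycle _)) ()

  B-dominating : Dominating B
  B-dominating (i , j) ¬b with B-neighbour {red P i} j ¬b
  ... | l , b , inj₁ e = (i , l) , b , inj₁ (inner e)
  ... | l , b , inj₂ e = (i , l) , b , inj₂ (inner e)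

module Transport {n} (G : Graph n) (P : CubicParams) (f : Fin n ⤖ Vtx P)
  (iso : ∀ u v → (Adj G u v → CAdj P (Bijection.to f u) (Bijection.to f v))
               × (CAdj P (Bijection.to f u) (Bijection.to f v) → Adj G u v)) where
  open Construction P

  e : Fin n ↔ Vtx P
  e = ⤖⇒↔ f

  open Inverse e using (to; from)

  to-from : ∀ x → to (from x) ≡ x
  to-from = Inverse.strictlyInverseˡ e

  from-to : ∀ u → from (to u) ≡ u
  from-to = Inverse.strictlyInverseʳ e

  adj-from : ∀ {x y} → CAdj P x y → Adj G (from x) (from y)
  adj-from {x} {y} c = proj₂ (iso (from x) (from y))
    (subst₂ (CAdj P) (≡-sym (to-from x)) (≡-sym (to-from y)) c)

  n≡k*8 : n ≡ k P * 8
  n≡k*8 = ≡-sym (↔⇒≡ (↔-sym e ↔-∘ *↔×))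

  pull : Subset n → Vtx P → Bool
  pull S x = lookup S (from x)

  push : (Vtx P → Bool) → Subset n
  push T = tabulate (T ∘ to)

  pull-independent : ∀ {S} → IsIndependent G S → Independent (pull S)
  pull-independent ind {x} {y} c p q =
    ind (from x) (from y) (lookup⇒[]= _ _ p) (lookup⇒[]= _ _ q) (adj-from c)

  pull-dominating : ∀ {S} → IsDominating G S → Dominating (pull S)
  pull-dominating {S} dom x ¬p with dom (from x) (¬p ∘ []=⇒lookup)
  ... | u , u∈S , a = to u , trans (cong (lookup S) (from-to u)) ([]=⇒lookup u∈S) ,
                      subst (λ z → CAdj P z (to u)) (to-from x) (proj₁ (iso (from x) u) a)

  ∈push : ∀ T {u} → u ∈ push T → T (to u) ≡ true
  ∈push T {u} m = trans (≡-sym (lookup∘tabulate (T ∘ to) u)) ([]=⇒lookup m)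

  push-∈ : ∀ T {u} → T (to u) ≡ true → u ∈ push T
  push-∈ T {u} p = lookup⇒[]= u _ (trans (lookup∘tabulate (T ∘ to) u) p)

  push-independent : ∀ {T} → Independent T → IsIndependent G (push T)
  push-independent {T} ind u v u∈ v∈ a =
    ind (proj₁ (iso u v) a) (∈push T u∈) (∈push T v∈)

  push-dominating : ∀ {T} → Dominating T → IsDominating G (push T)
  push-dominating {T} dom u u∉ with dom (to u) (u∉ ∘ push-∈ T)
  ... | y , p , c = from y , push-∈ T (trans (cong T (to-from y)) p) ,
                    proj₂ (iso u (from y)) (subst (CAdj P (to u)) (≡-sym (to-from y)) c)

  ∣S∣≡size-pull : ∀ S → ∣ S ∣ ≡ size (pull S)
  ∣S∣≡size-pull S = trans (∣p∣≡∑bit S) (sum-↔-× e (bit ∘ lookup S))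

  ∣push∣≡size : ∀ T → ∣ push T ∣ ≡ size T
  ∣push∣≡size T = begin
    ∣ push T ∣                          ≡⟨ ∣p∣≡∑bit (push T) ⟩
    ∑[ u < n ] bit (lookup (push T) u)  ≡⟨ sum-cong-≗ (cong bit ∘ lookup∘tabulate (T ∘ to)) ⟩
    ∑[ u < n ] bit (T (to u))           ≡⟨ sum-↔-× e (bit ∘ T ∘ to) ⟩
    ∑[ i < k P ] ∑[ j < 8 ] bit (T (to (from (i , j))))
      ≡⟨ sum-cong-≗ (λ i → sum-cong-≗ (λ j → cong (bit ∘ T) (to-from (i , j)))) ⟩
    size T                              ∎
    where open ≡-Reasoning

8*[k*3]≡3*[k*8] : ∀ k → 8 * (k * 3) ≡ 3 * (k * 8)
8*[k*3]≡3*[k*8] = solve-∀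

theorem4 : ∀ (n : ℕ) (G : Graph n) → InFcubic G →
    n ≥ 16 × 8 ∣ n × ∃ λ m → IndepDomNumber G m × 8 * m ≡ 3 * n
theorem4 n G (P , f , iso) =
  subst (16 ≤_) (≡-sym n≡k*8) (*-monoˡ-≤ 8 (k≥2 P)) ,
  divides (k P) n≡k*8 ,
  k P * 3 ,
  ( (push B , (push-independent B-independent , push-dominating B-dominating) ,
     trans (∣push∣≡size B) size-B)
  , λ S (ind , dom) → subst (k P * 3 ≤_) (≡-sym (∣S∣≡size-pull S))
                        (size-≥3k (pull S) (pull-independent ind) (pull-dominating dom)) ) ,
  subst (λ z → 8 * (k P * 3) ≡ 3 * z) (≡-sym n≡k*8) (8*[k*3]≡3*[k*8] (k P))
  where
  open Construction P
  open Transport G P f iso
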